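{- Let $G=(V,E)$ be an unweighted graph, $v\in V$, $S\subseteq V$, and $k>0$ an integer such that $d_S(v)\le (d(v)-k)/2$. Then $C_{S\oplus v}\ge C_S+k$ and $\varphi(S\oplus v,k)\ge\varphi(S,k)$.
   Context: For a cut $S\subseteq V$, $C_S$ is the number of edges with exactly one endpoint in $S$; $d(v)$ is the degree of $v$ and $d_S(v)$ is the number of edges incident to $v$ with exactly one endpoint in $S$. $S\oplus v$ denotes $S\setminus\{v\}$ if $v\in S$ and $S\cup\{v\}$ otherwise. For $F\subseteq V$, $G-F$ is obtained by deleting $F$ and incident edges, and $\varphi(S,k)=\min_{F\subseteq V,|F|=k}C_{S-F,G-F}$, where $C_{S-F,G-F}$ is the size of the cut $S\setminus F$ in $G-F$. -}

module Defs where

open import Data.Bool using (Bool; true; false; if_then_else_; _xor_; _∧_; not)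
open import Data.Nat using (ℕ; zero; suc; _+_; _⊓_; _<ᵇ_; _≡ᵇ_)
open import Data.Fin using (Fin; toℕ)
open import Data.Fin.Subset using (Subset; ∣_∣; _─_)
open import Data.List using (List; []; _∷_; map; foldr; allFin; filter; _++_)
open import Data.Nat.ListAction using (sum)
open import Data.Vec using (Vec; []; _∷_; lookup; _[_]≔_)
open import Relation.Binary.PropositionalEquality using (_≡_)
open import Relation.Nullary.Decidable using (does)
open import Data.Nat.Properties using (_≟_)

record Graph (n : ℕ) : Set where
  field
    adj   : Fin n → Fin n → Bool
    sym   : ∀ u w → adj u w ≡ adj w u
    loopless : ∀ u → adj u u ≡ false
open Graph public

_∈ᵇ_ : ∀ {n} → Fin n → Subset n → Bool
v ∈ᵇ S = lookup S v

count : ∀ {n} → (Fin n → Bool) → ℕ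
count {n} p = sum (map (λ i → if p i then 1 else 0) (allFin n))

-- number of unordered pairs {u,w} (u ≠ w, counted once via toℕ u < toℕ w)
-- satisfying a predicate
countPairs : ∀ {n} → (Fin n → Fin n → Bool) → ℕ
countPairs p = sum (map (λ u → count (λ w → (toℕ u <ᵇ toℕ w) ∧ p u w)) (allFin _))

deg : ∀ {n} → Graph n → Fin n → ℕ
deg G v = count (λ w → adj G v w)

degCut : ∀ {n} → Graph n → Subset n → Fin n → ℕ
degCut G S v = count (λ w → adj G v w ∧ ((v ∈ᵇ S) xor (w ∈ᵇ S)))

cut : ∀ {n} → Graph n → Subset n → ℕ
cut G S = countPairs (λ u w → adj G u w ∧ ((u ∈ᵇ S) xor (w ∈ᵇ S)))

-- C_{S-F, G-F}: size of the cut S \ F in the graph G - F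
-- (edges of G with both endpoints outside F and exactly one endpoint in S \ F)
cutDel : ∀ {n} → Graph n → Subset n → Subset n → ℕ
cutDel G S F = countPairs (λ u w → adj G u w ∧ not (u ∈ᵇ F) ∧ not (w ∈ᵇ F)
                                     ∧ ((u ∈ᵇ (S ─ F)) xor (w ∈ᵇ (S ─ F))))

_⊕_ : ∀ {n} → Subset n → Fin n → Subset n
S ⊕ v = S [ v ]≔ not (v ∈ᵇ S)

allSubsets : (n : ℕ) → List (Subset n)
allSubsets zero = [] ∷ []
allSubsets (suc n) = map (true ∷_) (allSubsets n) ++ map (false ∷_) (allSubsets n)

minimumOr : ℕ → List ℕ → ℕ
minimumOr d [] = d
minimumOr _ (x ∷ xs) = foldr _⊓_ x xs

-- φ(S,k) = min over F ⊆ V with |F| = k of C_{S-F,G-F}.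
-- (Only meaningful when k ≤ n; for k > n there is no such F and the value 0 is a dummy.)
φ : ∀ {n} → Graph n → Subset n → ℕ → ℕ
φ {n} G S k = minimumOr 0 (map (cutDel G S) (filter (λ F → ∣ F ∣ ≟ k) (allSubsets n)))

module Submission where

-- Flipping v only changes the status of the edges at v: the d_S(v) cut edges at v leave the cut
-- and the other d(v) − d_S(v) edges at v enter it. Since the edges of any graph are those
-- avoiding v plus the d(v) edges at v, this gives C_{S⊕v} + d_S(v) = C_S + d(v) − d_S(v), hence
-- C_{S⊕v} ≥ C_S + k. For φ, compare both cuts in G − F for each F with |F| = k: if v ∈ F then v
-- is isolated there; otherwise v keeps at least d(v) − k of its edges while its cut degree can
-- only drop, so d(v) ≥ 2 d_S(v) still holds in G − F and the flip argument applies with k = 0.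

open import Data.Bool using (Bool; true; false; not; _∧_; _∨_; _xor_; T; if_then_else_)
open import Data.Bool.Properties using (∧-identityʳ; ∧-zeroʳ; ∧-comm; xor-comm; not-distribˡ-xor)
open import Data.Empty using (⊥; ⊥-elim)
open import Data.Fin using (Fin; zero; suc; toℕ)
open import Data.Fin.Properties using (_≟_; suc-injective; toℕ-injective)
open import Data.Fin.Subset using (Subset; ∣_∣; _─_)
open import Data.List using (map; foldr; allFin; tabulate)
open import Data.List.Properties using (map-tabulate; map-cong)
open import Data.List.Relation.Unary.All using (All; []; _∷_)
open import Data.List.Relation.Unary.All.Properties using (all-filter)
open import Data.Nat using (ℕ; zero; suc; _+_; _*_; _≤_; _≥_; _<ᵇ_; _⊓_; z≤n; NonZero)
open import Data.Nat.ListAction using (sum)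
open import Data.Nat.Properties
  using ( +-0-commutativeMonoid; +-commutativeSemigroup; ≤-refl; +-mono-≤; +-monoˡ-≤; +-monoʳ-≤
        ; +-cancelˡ-≤; +-cancelʳ-≤; *-monoʳ-≤; +-identityʳ; +-assoc; +-comm; ⊓-mono-≤
        ; <ᵇ⇒<; <-irrefl; module ≤-Reasoning)
  renaming (_≟_ to _≟ℕ_)
open import Data.Product using (_×_; _,_)
open import Data.Unit using (tt)
open import Data.Vec using ([]; _∷_; lookup)
open import Data.Vec.Properties using (lookup∘update; lookup∘update′)
open import Function using (_∘_; id)
open import Relation.Binary.PropositionalEquality as ≡
  using (_≡_; _≢_; refl; cong; cong₂; subst₂; module ≡-Reasoning)
open import Relation.Nullary.Decidable using (does; yes; no; dec-true; dec-false)

open import Algebra.Properties.CommutativeMonoid.Sum +-0-commutativeMonoid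
  using (∑-distrib-+; ∑-comm; sum-cong-≗; sum-replicate-zero)
  renaming (sum to ∑)
open import Algebra.Properties.CommutativeSemigroup +-commutativeSemigroup
  using (xy∙z≈xz∙y; xy∙z≈x∙zy)

open import Defs

𝟙 : Bool → ℕ
𝟙 b = if b then 1 else 0

𝟙-split : ∀ d x q → 𝟙 (d ∧ x) ≡ 𝟙 (d ∧ (x ∧ q)) + 𝟙 (d ∧ (x ∧ not q))
𝟙-split false x     q     = refl
𝟙-split true  false q     = refl
𝟙-split true  true  false = refl
𝟙-split true  true  true  = refl

𝟙-∧-∨ : ∀ d x a b → (T d → T a → T b → ⊥) →
        𝟙 (d ∧ (x ∧ (a ∨ b))) ≡ 𝟙 ((d ∧ x) ∧ a) + 𝟙 ((d ∧ x) ∧ b)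
𝟙-∧-∨ false x     a     b     _        = refl
𝟙-∧-∨ true  false a     b     _        = refl
𝟙-∧-∨ true  true  false b     _        = refl
𝟙-∧-∨ true  true  true  false _        = refl
𝟙-∧-∨ true  true  true  true  disjoint = ⊥-elim (disjoint tt tt tt)

𝟙-∧-partition : ∀ a b x → (T x → 𝟙 a + 𝟙 b ≡ 1) → 𝟙 (a ∧ x) + 𝟙 (b ∧ x) ≡ 𝟙 x
𝟙-∧-partition a b false _   rewrite ∧-zeroʳ a     | ∧-zeroʳ b     = refl
𝟙-∧-partition a b true  one rewrite ∧-identityʳ a | ∧-identityʳ b = one tt

𝟙-≤-∧-not-+ : ∀ x q → 𝟙 x ≤ 𝟙 (x ∧ not q) + 𝟙 q
𝟙-≤-∧-not-+ false q     = z≤n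
𝟙-≤-∧-not-+ true  false = ≤-refl
𝟙-≤-∧-not-+ true  true  = ≤-refl

𝟙-<ᵇ-exactlyOne : ∀ {m n} → m ≢ n → 𝟙 (m <ᵇ n) + 𝟙 (n <ᵇ m) ≡ 1
𝟙-<ᵇ-exactlyOne {zero}  {zero}  m≢n = ⊥-elim (m≢n refl)
𝟙-<ᵇ-exactlyOne {zero}  {suc n} _   = refl
𝟙-<ᵇ-exactlyOne {suc m} {zero}  _   = refl
𝟙-<ᵇ-exactlyOne {suc m} {suc n} m≢n = 𝟙-<ᵇ-exactlyOne (m≢n ∘ cong suc)

∑-mono : ∀ {n} {f g : Fin n → ℕ} → (∀ i → f i ≤ g i) → ∑ f ≤ ∑ g
∑-mono {zero}  _   = z≤n
∑-mono {suc n} f≤g = +-mono-≤ (f≤g zero) (∑-mono (f≤g ∘ suc))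

∑-zero : ∀ {n} {f : Fin n → ℕ} → (∀ i → f i ≡ 0) → ∑ f ≡ 0
∑-zero {n} f≡0 = ≡.trans (sum-cong-≗ f≡0) (sum-replicate-zero n)

∑-delta : ∀ {n} {f : Fin n → ℕ} (v : Fin n) → (∀ i → i ≢ v → f i ≡ 0) → ∑ f ≡ f v
∑-delta {f = f} zero off =
  ≡.trans (cong (f zero +_) (∑-zero (λ i → off (suc i) λ ()))) (+-identityʳ (f zero))
∑-delta (suc v) off =
  cong₂ _+_ (off zero λ ()) (∑-delta v (λ i i≢v → off (suc i) (i≢v ∘ suc-injective)))

sum-tabulate : ∀ {n} (f : Fin n → ℕ) → sum (tabulate f) ≡ ∑ f
sum-tabulate {zero}  f = refl
sum-tabulate {suc n} f = cong (f zero +_) (sum-tabulate (f ∘ suc))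

sum-map-allFin : ∀ {n} (f : Fin n → ℕ) → sum (map f (allFin n)) ≡ ∑ f
sum-map-allFin f = ≡.trans (cong sum (map-tabulate id f)) (sum-tabulate f)

count≡∑ : ∀ {n} (p : Fin n → Bool) → count p ≡ ∑ (𝟙 ∘ p)
count≡∑ p = sum-map-allFin (𝟙 ∘ p)

count-cong : ∀ {n} {p q : Fin n → Bool} → (∀ i → p i ≡ q i) → count p ≡ count q
count-cong p≡q = cong sum (map-cong (cong 𝟙 ∘ p≡q) (allFin _))

count-mono : ∀ {n} {p q : Fin n → Bool} → (∀ i → 𝟙 (p i) ≤ 𝟙 (q i)) → count p ≤ count q
count-mono {p = p} {q} p≤q = subst₂ _≤_ (≡.sym (count≡∑ p)) (≡.sym (count≡∑ q)) (∑-mono p≤q)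

count-zero : ∀ {n} {p : Fin n → Bool} → (∀ i → p i ≡ false) → count p ≡ 0
count-zero {p = p} p≡false = ≡.trans (count≡∑ p) (∑-zero (cong 𝟙 ∘ p≡false))

count-split : ∀ {n} (p q : Fin n → Bool) →
              count p ≡ count (λ i → p i ∧ q i) + count (λ i → p i ∧ not (q i))
count-split p q = begin
  count p                                            ≡⟨ count≡∑ p ⟩
  ∑ (𝟙 ∘ p)                                          ≡⟨ sum-cong-≗ (λ i → 𝟙-split true (p i) (q i)) ⟩
  ∑ (λ i → 𝟙 (p i ∧ q i) + 𝟙 (p i ∧ not (q i)))     ≡⟨ ∑-distrib-+ (𝟙 ∘ p∧q) (𝟙 ∘ p∧¬q) ⟩
  ∑ (λ i → 𝟙 (p i ∧ q i)) + ∑ (λ i → 𝟙 (p i ∧ not (q i)))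
    ≡⟨ cong₂ _+_ (count≡∑ p∧q) (count≡∑ p∧¬q) ⟨
  count (λ i → p i ∧ q i) + count (λ i → p i ∧ not (q i)) ∎
  where
  open ≡-Reasoning
  p∧q p∧¬q : _ → Bool
  p∧q i = p i ∧ q i
  p∧¬q i = p i ∧ not (q i)

count-≤-∧-not-+ : ∀ {n} (p q : Fin n → Bool) → count p ≤ count (λ i → p i ∧ not (q i)) + count q
count-≤-∧-not-+ p q = begin
  count p                                        ≡⟨ count≡∑ p ⟩
  ∑ (𝟙 ∘ p)                                      ≤⟨ ∑-mono (λ i → 𝟙-≤-∧-not-+ (p i) (q i)) ⟩
  ∑ (λ i → 𝟙 (p i ∧ not (q i)) + 𝟙 (q i))       ≡⟨ ∑-distrib-+ (𝟙 ∘ p∧¬q) (𝟙 ∘ q) ⟩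
  ∑ (λ i → 𝟙 (p i ∧ not (q i))) + ∑ (𝟙 ∘ q)     ≡⟨ cong₂ _+_ (count≡∑ p∧¬q) (count≡∑ q) ⟨
  count (λ i → p i ∧ not (q i)) + count q        ∎
  where
  open ≤-Reasoning
  p∧¬q : _ → Bool
  p∧¬q i = p i ∧ not (q i)

∣∣≡∑ : ∀ {n} (F : Subset n) → ∣ F ∣ ≡ ∑ (𝟙 ∘ lookup F)
∣∣≡∑ []          = refl
∣∣≡∑ (true ∷ F)  = cong suc (∣∣≡∑ F)
∣∣≡∑ (false ∷ F) = ∣∣≡∑ F

∣∣≡count : ∀ {n} (F : Subset n) → ∣ F ∣ ≡ count (lookup F)
∣∣≡count F = ≡.trans (∣∣≡∑ F) (≡.sym (count≡∑ (lookup F)))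

_≺_ : ∀ {n} → Fin n → Fin n → Bool
u ≺ w = toℕ u <ᵇ toℕ w

countPairs≡∑∑ : ∀ {n} (p : Fin n → Fin n → Bool) →
                countPairs p ≡ ∑ (λ u → ∑ (λ w → 𝟙 (u ≺ w ∧ p u w)))
countPairs≡∑∑ p = ≡.trans (sum-map-allFin (λ u → count (row u))) (sum-cong-≗ (count≡∑ ∘ row))
  where
  row : _ → _ → Bool
  row u w = u ≺ w ∧ p u w

countPairs-cong : ∀ {n} {p q : Fin n → Fin n → Bool} → (∀ u w → p u w ≡ q u w) →
                  countPairs p ≡ countPairs q
countPairs-cong {p = p} {q} p≡q = ≡.trans (countPairs≡∑∑ p) (≡.trans
  (sum-cong-≗ (λ u → sum-cong-≗ (λ w → cong (λ b → 𝟙 (u ≺ w ∧ b)) (p≡q u w))))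
  (≡.sym (countPairs≡∑∑ q)))

countPairs-split : ∀ {n} (p q : Fin n → Fin n → Bool) →
  countPairs p ≡ countPairs (λ u w → p u w ∧ q u w) + countPairs (λ u w → p u w ∧ not (q u w))
countPairs-split p q = begin
  countPairs p
    ≡⟨ countPairs≡∑∑ p ⟩
  ∑ (λ u → ∑ (λ w → 𝟙 (u ≺ w ∧ p u w)))
    ≡⟨ sum-cong-≗ (λ u → ≡.trans (sum-cong-≗ (λ w → 𝟙-split (u ≺ w) (p u w) (q u w)))
                                 (∑-distrib-+ (in-p∧q u) (in-p∧¬q u))) ⟩
  ∑ (λ u → ∑ (in-p∧q u) + ∑ (in-p∧¬q u))
    ≡⟨ ∑-distrib-+ (∑ ∘ in-p∧q) (∑ ∘ in-p∧¬q) ⟩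
  ∑ (∑ ∘ in-p∧q) + ∑ (∑ ∘ in-p∧¬q)
    ≡⟨ cong₂ _+_ (countPairs≡∑∑ (λ u w → p u w ∧ q u w))
                 (countPairs≡∑∑ (λ u w → p u w ∧ not (q u w))) ⟨
  countPairs (λ u w → p u w ∧ q u w) + countPairs (λ u w → p u w ∧ not (q u w)) ∎
  where
  open ≡-Reasoning
  in-p∧q in-p∧¬q : _ → _ → ℕ
  in-p∧q  u w = 𝟙 (u ≺ w ∧ (p u w ∧ q u w))
  in-p∧¬q u w = 𝟙 (u ≺ w ∧ (p u w ∧ not (q u w)))

∑-𝟙-∧-≟ : ∀ {n} (r : Fin n → Bool) (v : Fin n) → ∑ (λ i → 𝟙 (r i ∧ does (i ≟ v))) ≡ 𝟙 (r v)
∑-𝟙-∧-≟ r v = ≡.trans (∑-delta v off-v) at-v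
  where
  off-v : ∀ i → i ≢ v → 𝟙 (r i ∧ does (i ≟ v)) ≡ 0
  off-v i i≢v rewrite dec-false (i ≟ v) i≢v | ∧-zeroʳ (r i) = refl
  at-v : 𝟙 (r v ∧ does (v ≟ v)) ≡ 𝟙 (r v)
  at-v rewrite dec-true (v ≟ v) refl | ∧-identityʳ (r v) = refl

size : ∀ {n} → Graph n → ℕ
size H = countPairs (adj H)

adjacent⇒distinct : ∀ {n} (H : Graph n) {u w} → T (adj H u w) → u ≢ w
adjacent⇒distinct H {u} adj-uu refl = ≡.subst T (loopless H u) adj-uu

touches : ∀ {n} → Fin n → Fin n → Fin n → Bool
touches v u w = does (u ≟ v) ∨ does (w ≟ v)

countPairs-touching≡deg : ∀ {n} (H : Graph n) (v : Fin n) →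
                          countPairs (λ u w → adj H u w ∧ touches v u w) ≡ deg H v
countPairs-touching≡deg H v = begin
  countPairs (λ u w → a u w ∧ touches v u w)
    ≡⟨ countPairs≡∑∑ (λ u w → a u w ∧ touches v u w) ⟩
  ∑ (λ u → ∑ (λ w → 𝟙 (u ≺ w ∧ (a u w ∧ (at-v u ∨ at-v w)))))
    ≡⟨ sum-cong-≗ (λ u → ≡.trans (sum-cong-≗ (split u)) (∑-distrib-+ (from-v u) (to-v u))) ⟩
  ∑ (λ u → ∑ (from-v u) + ∑ (to-v u))
    ≡⟨ ∑-distrib-+ (∑ ∘ from-v) (∑ ∘ to-v) ⟩
  ∑ (∑ ∘ from-v) + ∑ (∑ ∘ to-v)
    ≡⟨ cong (_+ ∑ (∑ ∘ to-v)) (∑-comm from-v) ⟩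
  ∑ (λ w → ∑ (λ u → from-v u w)) + ∑ (∑ ∘ to-v)
    ≡⟨ cong₂ _+_ (sum-cong-≗ (λ w → ∑-𝟙-∧-≟ (λ u → u ≺ w ∧ a u w) v))
                 (sum-cong-≗ (λ u → ∑-𝟙-∧-≟ (λ w → u ≺ w ∧ a u w) v)) ⟩
  ∑ (λ w → 𝟙 (v ≺ w ∧ a v w)) + ∑ (λ u → 𝟙 (u ≺ v ∧ a u v))
    ≡⟨ ∑-distrib-+ (λ w → 𝟙 (v ≺ w ∧ a v w)) (λ w → 𝟙 (w ≺ v ∧ a w v)) ⟨
  ∑ (λ w → 𝟙 (v ≺ w ∧ a v w) + 𝟙 (w ≺ v ∧ a w v))
    ≡⟨ sum-cong-≗ counted-once ⟩
  ∑ (𝟙 ∘ a v)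
    ≡⟨ count≡∑ (a v) ⟨
  deg H v ∎
  where
  open ≡-Reasoning
  a = adj H
  at-v : _ → Bool
  at-v u = does (u ≟ v)
  from-v to-v : _ → _ → ℕ
  from-v u w = 𝟙 ((u ≺ w ∧ a u w) ∧ at-v u)
  to-v   u w = 𝟙 ((u ≺ w ∧ a u w) ∧ at-v w)
  disjoint : ∀ u w → T (u ≺ w) → T (at-v u) → T (at-v w) → ⊥
  disjoint u w u≺w with u ≟ v | w ≟ v
  ... | yes refl | yes refl = λ _ _ → <-irrefl refl (<ᵇ⇒< (toℕ v) (toℕ v) u≺w)
  ... | yes _    | no _     = λ _ ()
  ... | no _     | _        = λ ()
  split : ∀ u w → 𝟙 (u ≺ w ∧ (a u w ∧ (at-v u ∨ at-v w))) ≡ from-v u w + to-v u w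
  split u w = 𝟙-∧-∨ (u ≺ w) (a u w) (at-v u) (at-v w) (disjoint u w)
  counted-once : ∀ w → 𝟙 (v ≺ w ∧ a v w) + 𝟙 (w ≺ v ∧ a w v) ≡ 𝟙 (a v w)
  counted-once w rewrite sym H w v =
    𝟙-∧-partition (v ≺ w) (w ≺ v) (a v w)
      (λ adj-vw → 𝟙-<ᵇ-exactlyOne (adjacent⇒distinct H adj-vw ∘ toℕ-injective))

edgesAvoiding : ∀ {n} → Fin n → Graph n → ℕ
edgesAvoiding v H = countPairs (λ u w → adj H u w ∧ not (touches v u w))

size≡edgesAvoiding+deg : ∀ {n} (H : Graph n) (v : Fin n) → size H ≡ edgesAvoiding v H + deg H v
size≡edgesAvoiding+deg H v = ≡.trans (countPairs-split (adj H) (touches v))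
  (≡.trans (cong (_+ edgesAvoiding v H) (countPairs-touching≡deg H v))
           (+-comm (deg H v) (edgesAvoiding v H)))

edgesAvoiding-cong : ∀ {n} (H H′ : Graph n) (v : Fin n) →
                     (∀ u w → u ≢ v → w ≢ v → adj H u w ≡ adj H′ u w) →
                     edgesAvoiding v H ≡ edgesAvoiding v H′
edgesAvoiding-cong H H′ v agree = countPairs-cong pointwise
  where
  pointwise : ∀ u w → adj H u w ∧ not (touches v u w) ≡ adj H′ u w ∧ not (touches v u w)
  pointwise u w with u ≟ v | w ≟ v
  ... | yes _  | _      = ≡.trans (∧-zeroʳ _) (≡.sym (∧-zeroʳ _))
  ... | no _   | yes _  = ≡.trans (∧-zeroʳ _) (≡.sym (∧-zeroʳ _))
  ... | no u≢v | no w≢v = cong (_∧ true) (agree u w u≢v w≢v)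

size+deg-swap : ∀ {n} (H H′ : Graph n) (v : Fin n) →
                (∀ u w → u ≢ v → w ≢ v → adj H u w ≡ adj H′ u w) →
                size H + deg H′ v ≡ size H′ + deg H v
size+deg-swap H H′ v agree = begin
  size H + deg H′ v                          ≡⟨ cong (_+ deg H′ v) (size≡edgesAvoiding+deg H v) ⟩
  edgesAvoiding v H + deg H v + deg H′ v     ≡⟨ xy∙z≈xz∙y (edgesAvoiding v H) (deg H v) (deg H′ v) ⟩
  edgesAvoiding v H + deg H′ v + deg H v     ≡⟨ cong (λ m → m + deg H′ v + deg H v)
                                                     (edgesAvoiding-cong H H′ v agree) ⟩
  edgesAvoiding v H′ + deg H′ v + deg H v    ≡⟨ cong (_+ deg H v) (size≡edgesAvoiding+deg H′ v) ⟨
  size H′ + deg H v                          ∎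
  where open ≡-Reasoning

cutGraph : ∀ {n} → Graph n → Subset n → Graph n
cutGraph G S = record
  { adj      = λ u w → adj G u w ∧ ((u ∈ᵇ S) xor (w ∈ᵇ S))
  ; sym      = λ u w → cong₂ _∧_ (sym G u w) (xor-comm (u ∈ᵇ S) (w ∈ᵇ S))
  ; loopless = λ u → cong (_∧ _) (loopless G u)
  }

module _ {n} (G : Graph n) (S : Subset n) (v : Fin n) where

  cutGraph-⊕-agree : ∀ u w → u ≢ v → w ≢ v → adj (cutGraph G S) u w ≡ adj (cutGraph G (S ⊕ v)) u w
  cutGraph-⊕-agree u w u≢v w≢v
    rewrite lookup∘update′ u≢v S (not (v ∈ᵇ S)) | lookup∘update′ w≢v S (not (v ∈ᵇ S)) = refl

  cutGraph-⊕-at : ∀ w → adj (cutGraph G (S ⊕ v)) v w ≡ adj G v w ∧ not ((v ∈ᵇ S) xor (w ∈ᵇ S))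
  cutGraph-⊕-at w with w ≟ v
  ... | yes refl rewrite loopless G v = refl
  ... | no w≢v rewrite lookup∘update v S (not (v ∈ᵇ S)) | lookup∘update′ w≢v S (not (v ∈ᵇ S)) =
    cong (adj G v w ∧_) (≡.sym (not-distribˡ-xor (v ∈ᵇ S) (w ∈ᵇ S)))

  deg≡degCut+degCut-⊕ : deg G v ≡ degCut G S v + degCut G (S ⊕ v) v
  deg≡degCut+degCut-⊕ = ≡.trans (count-split (adj G v) (λ w → (v ∈ᵇ S) xor (w ∈ᵇ S)))
    (cong (degCut G S v +_) (≡.sym (count-cong cutGraph-⊕-at)))

  cut-⊕-flip : cut G S + degCut G (S ⊕ v) v ≡ cut G (S ⊕ v) + degCut G S v
  cut-⊕-flip = size+deg-swap (cutGraph G S) (cutGraph G (S ⊕ v)) v cutGraph-⊕-agree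

  cut-⊕-gain : ∀ k → 2 * degCut G S v + k ≤ deg G v → cut G S + k ≤ cut G (S ⊕ v)
  cut-⊕-gain k balanced = +-cancelʳ-≤ d (cut G S + k) (cut G (S ⊕ v)) (begin
    cut G S + k + d    ≡⟨ xy∙z≈x∙zy (cut G S) k d ⟩
    cut G S + (d + k)  ≤⟨ +-monoʳ-≤ (cut G S) d+k≤d′ ⟩
    cut G S + d′       ≡⟨ cut-⊕-flip ⟩
    cut G (S ⊕ v) + d  ∎)
    where
    open ≤-Reasoning
    d d′ : ℕ
    d  = degCut G S v
    d′ = degCut G (S ⊕ v) v
    d+k≤d′ : d + k ≤ d′
    d+k≤d′ = +-cancelˡ-≤ d (d + k) d′ (begin
      d + (d + k)  ≡⟨ +-assoc d d k ⟨
      d + d + k    ≡⟨ cong (λ m → d + m + k) (+-identityʳ d) ⟨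
      2 * d + k    ≤⟨ balanced ⟩
      deg G v      ≡⟨ deg≡degCut+degCut-⊕ ⟩
      d + d′       ∎)

lookup-─ : ∀ {n} (S F : Subset n) i → i ∈ᵇ (S ─ F) ≡ (i ∈ᵇ S) ∧ not (i ∈ᵇ F)
lookup-─ (s ∷ S) (true ∷ F)  zero    = ≡.sym (∧-zeroʳ s)
lookup-─ (s ∷ S) (false ∷ F) zero    = ≡.sym (∧-identityʳ s)
lookup-─ (_ ∷ S) (_ ∷ F)     (suc i) = lookup-─ S F i

-- G − F keeps the vertices of F, as isolated vertices.
_∖_ : ∀ {n} → Graph n → Subset n → Graph n
G ∖ F = record
  { adj      = λ u w → adj G u w ∧ (not (u ∈ᵇ F) ∧ not (w ∈ᵇ F))
  ; sym      = λ u w → cong₂ _∧_ (sym G u w) (∧-comm (not (u ∈ᵇ F)) (not (w ∈ᵇ F)))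
  ; loopless = λ u → cong (_∧ _) (loopless G u)
  }

cutDel≡cut-∖ : ∀ {n} (G : Graph n) (S F : Subset n) → cutDel G S F ≡ cut (G ∖ F) S
cutDel≡cut-∖ G S F = countPairs-cong pointwise
  where
  regroup : ∀ a fu fw su sw → a ∧ not fu ∧ not fw ∧ ((su ∧ not fu) xor (sw ∧ not fw))
                            ≡ (a ∧ (not fu ∧ not fw)) ∧ (su xor sw)
  regroup false _     _     _  _  = refl
  regroup true  true  _     _  _  = refl
  regroup true  false true  _  _  = refl
  regroup true  false false su sw rewrite ∧-identityʳ su | ∧-identityʳ sw = refl
  pointwise : ∀ u w → adj G u w ∧ not (u ∈ᵇ F) ∧ not (w ∈ᵇ F) ∧ ((u ∈ᵇ (S ─ F)) xor (w ∈ᵇ (S ─ F)))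
                    ≡ adj (G ∖ F) u w ∧ ((u ∈ᵇ S) xor (w ∈ᵇ S))
  pointwise u w rewrite lookup-─ S F u | lookup-─ S F w =
    regroup (adj G u w) (u ∈ᵇ F) (w ∈ᵇ F) (u ∈ᵇ S) (w ∈ᵇ S)

module _ {n} (G : Graph n) (S F : Subset n) (v : Fin n) where

  degCut-∖-≤ : degCut (G ∖ F) S v ≤ degCut G S v
  degCut-∖-≤ = count-mono (λ w → drop (adj G v w) (not (v ∈ᵇ F) ∧ not (w ∈ᵇ F)) _)
    where
    drop : ∀ a b x → 𝟙 ((a ∧ b) ∧ x) ≤ 𝟙 (a ∧ x)
    drop false _     _ = z≤n
    drop true  false _ = z≤n
    drop true  true  _ = ≤-refl

  degCut-∖-removed : v ∈ᵇ F ≡ true → degCut (G ∖ F) S v ≡ 0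
  degCut-∖-removed v∈F = count-zero λ w →
    ≡.trans (cong (λ b → (adj G v w ∧ (not b ∧ _)) ∧ _) v∈F) (cong (_∧ _) (∧-zeroʳ (adj G v w)))

  deg-≤-deg-∖+∣∣ : v ∈ᵇ F ≡ false → deg G v ≤ deg (G ∖ F) v + ∣ F ∣
  deg-≤-deg-∖+∣∣ v∉F = begin
    deg G v                                           ≤⟨ count-≤-∧-not-+ (adj G v) (lookup F) ⟩
    count (λ w → adj G v w ∧ not (w ∈ᵇ F)) + count (lookup F)
      ≡⟨ cong₂ _+_ (count-cong (λ w → cong (λ b → adj G v w ∧ (not b ∧ not (w ∈ᵇ F))) v∉F))
                   (∣∣≡count F) ⟨
    deg (G ∖ F) v + ∣ F ∣                             ∎
    where open ≤-Reasoning

  ∖-balanced : 2 * degCut G S v + ∣ F ∣ ≤ deg G v → 2 * degCut (G ∖ F) S v ≤ deg (G ∖ F) v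
  ∖-balanced balanced = by-membership (v ∈ᵇ F) refl
    where
    open ≤-Reasoning
    by-membership : ∀ b → v ∈ᵇ F ≡ b → 2 * degCut (G ∖ F) S v ≤ deg (G ∖ F) v
    by-membership true  v∈F rewrite degCut-∖-removed v∈F = z≤n
    by-membership false v∉F = +-cancelʳ-≤ ∣ F ∣ _ _ (begin
      2 * degCut (G ∖ F) S v + ∣ F ∣  ≤⟨ +-monoˡ-≤ ∣ F ∣ (*-monoʳ-≤ 2 degCut-∖-≤) ⟩
      2 * degCut G S v + ∣ F ∣        ≤⟨ balanced ⟩
      deg G v                         ≤⟨ deg-≤-deg-∖+∣∣ v∉F ⟩
      deg (G ∖ F) v + ∣ F ∣           ∎)

  cutDel-⊕-mono : 2 * degCut G S v + ∣ F ∣ ≤ deg G v → cutDel G S F ≤ cutDel G (S ⊕ v) F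
  cutDel-⊕-mono balanced = begin
    cutDel G S F               ≡⟨ cutDel≡cut-∖ G S F ⟩
    cut (G ∖ F) S              ≡⟨ +-identityʳ _ ⟨
    cut (G ∖ F) S + 0          ≤⟨ cut-⊕-gain (G ∖ F) S v 0 balanced′ ⟩
    cut (G ∖ F) (S ⊕ v)        ≡⟨ cutDel≡cut-∖ G (S ⊕ v) F ⟨
    cutDel G (S ⊕ v) F         ∎
    where
    open ≤-Reasoning
    balanced′ : 2 * degCut (G ∖ F) S v + 0 ≤ deg (G ∖ F) v
    balanced′ = ≡.subst (_≤ deg (G ∖ F) v) (≡.sym (+-identityʳ _)) (∖-balanced balanced)

foldr-⊓-map-mono : ∀ {A : Set} {P : A → Set} {f g : A → ℕ} → (∀ x → P x → f x ≤ g x) →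
                   ∀ {a b} → a ≤ b → ∀ {xs} → All P xs → foldr _⊓_ a (map f xs) ≤ foldr _⊓_ b (map g xs)
foldr-⊓-map-mono f≤g a≤b []         = a≤b
foldr-⊓-map-mono f≤g a≤b (px ∷ pxs) = ⊓-mono-≤ (f≤g _ px) (foldr-⊓-map-mono f≤g a≤b pxs)

minimumOr-map-mono : ∀ {A : Set} {P : A → Set} {f g : A → ℕ} → (∀ x → P x → f x ≤ g x) →
                     ∀ d {xs} → All P xs → minimumOr d (map f xs) ≤ minimumOr d (map g xs)
minimumOr-map-mono f≤g d []         = ≤-refl
minimumOr-map-mono f≤g d (px ∷ pxs) = foldr-⊓-map-mono f≤g (f≤g _ px) pxs

φ-mono : ∀ {n} (G : Graph n) (S T : Subset n) k →
         (∀ F → ∣ F ∣ ≡ k → cutDel G S F ≤ cutDel G T F) → φ G S k ≤ φ G T k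
φ-mono {n} G S T k cutDel-≤ =
  minimumOr-map-mono cutDel-≤ 0 (all-filter (λ F → ∣ F ∣ ≟ℕ k) (allSubsets n))

lemma10 : ∀ {n} (G : Graph n) (v : Fin n) (S : Subset n) (k : ℕ) → .{{_ : NonZero k}}
    → 2 * degCut G S v + k ≤ deg G v
    → (cut G (S ⊕ v) ≥ cut G S + k) × (φ G (S ⊕ v) k ≥ φ G S k)
lemma10 G v S k balanced =
    cut-⊕-gain G S v k balanced
  , φ-mono G S (S ⊕ v) k (λ F ∣F∣≡k →
      cutDel-⊕-mono G S F v (≡.subst (λ m → 2 * degCut G S v + m ≤ deg G v) (≡.sym ∣F∣≡k) balanced))
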